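{- Let $G$ be a connected graph. Then the following statements are equivalent: (A1) $G$ is $\{P_4, C_4, \text{paw}, \text{diamond}\}$-free; (A2) every graph search ordering of $G$ is a DFS ordering of $G$; (A3) every graph search ordering of $G$ is a BFS ordering of $G$; (A4) an ordering of $V(G)$ is a BFS ordering of $G$ if and only if it is a DFS ordering of $G$.
   Context: All graphs are finite and simple. For an ordering $\sigma$ of $V(G)$ write $x<_\sigma y$ if $x$ precedes $y$ in $\sigma$. A graph search (generic search) ordering of $G$ is an ordering of $V(G)$ such that every prefix induces a connected subgraph. An ordering $\sigma$ of $V(G)$ is a BFS ordering if whenever $a<_\sigma b<_\sigma c$, $ac\in E(G)$ and $ab\notin E(G)$, there is a vertex $d$ with $d<_\sigma a$ and $db\in E(G)$. It is a DFS ordering if whenever $a<_\sigma b<_\sigma c$, $ac\in E(G)$ and $ab\notin E(G)$, there is a vertex $d$ with $a<_\sigma d<_\sigma b$ and $db\in E(G)$. The paw is the graph consisting of a triangle plus one extra vertex adjacent to exactly one vertex of the triangle; the diamond is $K_4$ minus one edge. $G$ is $\mathcal{F}$-free if it contains no induced subgraph isomorphic to a member of $\mathcal{F}$. -}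

module Defs where

open import Data.Nat using (ℕ)
open import Data.Bool using (Bool; true; false)
open import Data.Fin using (Fin; zero; suc; _<_; toℕ)
open import Data.Fin.Permutation using (Permutation′; _⟨$⟩ʳ_)
open import Data.Vec using (Vec; []; _∷_; lookup)
open import Data.Product using (Σ; _×_; _,_; ∃)
open import Relation.Nullary using (¬_)
open import Relation.Binary.PropositionalEquality using (_≡_)
open import Relation.Binary.Construct.Closure.ReflexiveTransitive using (Star)
open import Function.Definitions using (Injective)

record Graph : Set where
  field
    n      : ℕ
    adj    : Fin n → Fin n → Bool
    sym    : ∀ x y → adj x y ≡ adj y x
    irrefl : ∀ x → adj x x ≡ false

open Graph public

V : Graph → Set
V G = Fin (n G)

Adj : (G : Graph) → V G → V G → Set
Adj G x y = adj G x y ≡ true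

InducedEdge : (G : Graph) → (V G → Set) → V G → V G → Set
InducedEdge G P x y = Adj G x y × P x × P y

InducedConnected : (G : Graph) → (V G → Set) → Set
InducedConnected G P = ∀ u v → P u → P v → Star (InducedEdge G P) u v

Connected : Graph → Set
Connected G = ∀ (u v : V G) → Star (λ x y → Adj G x y) u v

-- An ordering of V(G): σ ⟨$⟩ʳ x is the position of vertex x.
Ordering : Graph → Set
Ordering G = Permutation′ (n G)

Before : (G : Graph) → Ordering G → V G → V G → Set
Before G σ x y = (σ ⟨$⟩ʳ x) < (σ ⟨$⟩ʳ y)

IsSearch : (G : Graph) → Ordering G → Set
IsSearch G σ = ∀ (k : ℕ) → InducedConnected G (λ x → toℕ (σ ⟨$⟩ʳ x) Data.Nat.< k)

IsBFS : (G : Graph) → Ordering G → Set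
IsBFS G σ = ∀ (a b c : V G) → Before G σ a b → Before G σ b c → Adj G a c → ¬ Adj G a b →
  Σ (V G) (λ d → Before G σ d a × Adj G d b)

IsDFS : (G : Graph) → Ordering G → Set
IsDFS G σ = ∀ (a b c : V G) → Before G σ a b → Before G σ b c → Adj G a c → ¬ Adj G a b →
  Σ (V G) (λ d → Before G σ a d × Before G σ d b × Adj G d b)

Mat4 : Set
Mat4 = Vec (Vec Bool 4) 4

adjM : Mat4 → Fin 4 → Fin 4 → Bool
adjM M i j = lookup (lookup M i) j

-- P4: 0-1-2-3
P4 : Mat4
P4 = (false ∷ true  ∷ false ∷ false ∷ [])
   ∷ (true  ∷ false ∷ true  ∷ false ∷ [])
   ∷ (false ∷ true  ∷ false ∷ true  ∷ [])
   ∷ (false ∷ false ∷ true  ∷ false ∷ [])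
   ∷ []

-- C4: 0-1-2-3-0
C4 : Mat4
C4 = (false ∷ true  ∷ false ∷ true  ∷ [])
   ∷ (true  ∷ false ∷ true  ∷ false ∷ [])
   ∷ (false ∷ true  ∷ false ∷ true  ∷ [])
   ∷ (true  ∷ false ∷ true  ∷ false ∷ [])
   ∷ []

-- paw: triangle 0,1,2 and pendant vertex 3 adjacent to 0
Paw : Mat4
Paw = (false ∷ true  ∷ true  ∷ true  ∷ [])
    ∷ (true  ∷ false ∷ true  ∷ false ∷ [])
    ∷ (true  ∷ true  ∷ false ∷ false ∷ [])
    ∷ (true  ∷ false ∷ false ∷ false ∷ [])
    ∷ []

-- diamond: K4 minus the edge 23
Diamond : Mat4
Diamond = (false ∷ true  ∷ true  ∷ true  ∷ [])
        ∷ (true  ∷ false ∷ true  ∷ true  ∷ [])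
        ∷ (true  ∷ true  ∷ false ∷ false ∷ [])
        ∷ (true  ∷ true  ∷ false ∷ false ∷ [])
        ∷ []

ContainsInduced : (G : Graph) → Mat4 → Set
ContainsInduced G H = Σ (Fin 4 → V G) λ f →
  Injective _≡_ _≡_ f × (∀ i j → adjM H i j ≡ adj G (f i) (f j))

Free4 : Graph → Set
Free4 G = ¬ ContainsInduced G P4 × ¬ ContainsInduced G C4
        × ¬ ContainsInduced G Paw × ¬ ContainsInduced G Diamond

{-# OPTIONS --safe #-}
-- In a connected {P4, C4, paw, diamond}-free graph (a clique or a star) two non-adjacent vertices
-- a, b have a common neighbour, and it is the only neighbour of either. So there is no triple
-- a <σ b <σ c with ac an edge and ab not whenever σ is a search ordering (the prefix ending at b
-- joins a to b through a common neighbour, which would have to be c) or a BFS or DFS ordering (the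
-- neighbour of b these provide would have to be c): every BFS/DFS condition holds vacuously.
-- Conversely each forbidden graph contains an induced path a – r – b and a neighbour c of a outside
-- {r, b}; a search started r, a, b and continued breadth-first is BFS but not DFS, and a search
-- started a, r, b, c is not BFS.

module Submission where

open import Defs
open import Data.Bool as Bool using (true; false)
open import Data.Bool.Properties using (¬-not)
open import Data.Empty using (⊥; ⊥-elim)
open import Data.Fin as F using (Fin; suc; toℕ; fromℕ<)
open import Data.Fin.Patterns using (0F; 1F; 2F; 3F)
open import Data.Fin.Permutation using (_⟨$⟩ʳ_; permutation)
open import Data.Fin.Properties as FP using (all?)
open import Data.Nat as ℕ using (ℕ; zero; suc; _<_; _≤_; _+_; z≤n; s≤s)
open import Data.Nat.Induction using (<-rec)
import Data.Nat.Properties as NP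
open import Data.Product using (_×_; _,_; ∃; ∃₂; Σ; proj₁; proj₂)
open import Data.Sum using (_⊎_; inj₁; inj₂)
open import Data.Unit using (tt)
open import Data.Vec using (_∷_; []; lookup)
open import Function using (_∘_; case_of_)
open import Function.Bundles using (_⇔_; mk⇔; Equivalence)
open import Function.Definitions using (Injective)
open import Relation.Binary.Construct.Closure.ReflexiveTransitive as Star using (Star; ε; _◅_; _◅◅_)
open import Relation.Binary.Definitions using (tri<; tri≈; tri>)
open import Relation.Binary.PropositionalEquality as ≡
  using (_≡_; _≢_; refl; trans; cong; subst; subst₂; ≢-sym)
open import Relation.Nullary using (¬_; Dec; yes; no)
open import Relation.Nullary.Decidable using (decidable-stable; from-yes; ¬?; _×-dec_)
open import Relation.Unary using (Decidable)

IsSimple : Mat4 → Set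
IsSimple H = (∀ i → adjM H i i ≡ false) × (∀ i j → adjM H i j ≡ adjM H j i)

isSimple? : ∀ H → Dec (IsSimple H)
isSimple? H = all? (λ i → adjM H i i Bool.≟ false)
        ×-dec all? (λ i → all? (λ j → adjM H i j Bool.≟ adjM H j i))

P4-simple : IsSimple P4
P4-simple = from-yes (isSimple? P4)

C4-simple : IsSimple C4
C4-simple = from-yes (isSimple? C4)

Paw-simple : IsSimple Paw
Paw-simple = from-yes (isSimple? Paw)

Diamond-simple : IsSimple Diamond
Diamond-simple = from-yes (isSimple? Diamond)

module _ {ℓ} (R : Fin 4 → Fin 4 → Set ℓ) where

  fin4-ordered : R 0F 1F → R 0F 2F → R 0F 3F → R 1F 2F → R 1F 3F → R 2F 3F →
                 ∀ {i j} → i F.< j → R i j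
  fin4-ordered r01 r02 r03 r12 r13 r23 {0F} {1F} _ = r01
  fin4-ordered r01 r02 r03 r12 r13 r23 {0F} {2F} _ = r02
  fin4-ordered r01 r02 r03 r12 r13 r23 {0F} {3F} _ = r03
  fin4-ordered r01 r02 r03 r12 r13 r23 {1F} {2F} _ = r12
  fin4-ordered r01 r02 r03 r12 r13 r23 {1F} {3F} _ = r13
  fin4-ordered r01 r02 r03 r12 r13 r23 {2F} {3F} _ = r23
  fin4-ordered _ _ _ _ _ _ {_} {0F} ()
  fin4-ordered _ _ _ _ _ _ {suc _} {1F} (s≤s ())
  fin4-ordered _ _ _ _ _ _ {suc (suc _)} {2F} (s≤s (s≤s ()))
  fin4-ordered _ _ _ _ _ _ {suc (suc (suc _))} {3F} (s≤s (s≤s (s≤s ())))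

module _ {m : ℕ} {ℓ} {R : Fin m → Fin m → Set ℓ} where

  ordered⇒total : (∀ {i j} → i F.< j → R i j) → (∀ {i j} → R i j → R j i) → (∀ i → R i i) →
                  ∀ i j → R i j
  ordered⇒total ord symm refl' i j with FP.<-cmp i j
  ... | tri< i<j _ _ = ord i<j
  ... | tri≈ _ refl _ = refl' i
  ... | tri> _ _ j<i = symm (ord j<i)

module _ {m : ℕ} {A : Set} {f : Fin m → A} where

  ordered-distinct⇒injective : (∀ {i j} → i F.< j → f i ≢ f j) → Injective _≡_ _≡_ f
  ordered-distinct⇒injective distinct {i} {j} fi≡fj with FP.<-cmp i j
  ... | tri< i<j _ _ = ⊥-elim (distinct i<j fi≡fj)
  ... | tri≈ _ i≡j _ = i≡j
  ... | tri> _ _ j<i = ⊥-elim (distinct j<i (≡.sym fi≡fj))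

module _ {A : Set} {ℓ} {R : A → A → Set ℓ} {Q : A → Set} (Q? : Decidable Q) where

  walk-exits : ∀ {x y} → Star R x y → Q x → ¬ Q y → ∃₂ λ u v → R u v × Q u × ¬ Q v
  walk-exits ε qx ¬qy = ⊥-elim (¬qy qx)
  walk-exits (_◅_ {j = z} xz zy) qx ¬qy with Q? z
  ... | yes qz = walk-exits zy qz ¬qy
  ... | no ¬qz = _ , _ , xz , qx , ¬qz

least-witness : {P : ℕ → Set} → Decidable P → ∀ {m} → P m →
                ∃ λ α → P α × (∀ {β} → β < α → ¬ P β)
least-witness {P} P? {m} = <-rec _ least m
  where
  least : ∀ m → (∀ {k} → k < m → P k → ∃ λ α → P α × (∀ {β} → β < α → ¬ P β)) →
          P m → ∃ λ α → P α × (∀ {β} → β < α → ¬ P β)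
  least m rec pm with NP.anyUpTo? P? m
  ... | yes (β , β<m , pβ) = rec β<m pβ
  ... | no none = m , pm , λ β<m pβ → none (_ , β<m , pβ)

module _ (G : Graph) where

  private variable
    k : ℕ
    s t : ℕ → V G
    a b c d e u v x y : V G
    P : V G → Set

  adj? : ∀ x y → Dec (Adj G x y)
  adj? x y = adj G x y Bool.≟ true

  Adj-sym : Adj G x y → Adj G y x
  Adj-sym {x} {y} xy = trans (Graph.sym G y x) xy

  Adj⇒≢ : Adj G x y → x ≢ y
  Adj⇒≢ {x} xy refl with trans (≡.sym xy) (irrefl G x)
  ... | ()

  induced : (H : Mat4) → IsSimple H → (w x y z : V G) →
            w ≢ x → w ≢ y → w ≢ z → x ≢ y → x ≢ z → y ≢ z →
            adj G w x ≡ adjM H 0F 1F → adj G w y ≡ adjM H 0F 2F → adj G w z ≡ adjM H 0F 3F →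
            adj G x y ≡ adjM H 1F 2F → adj G x z ≡ adjM H 1F 3F → adj G y z ≡ adjM H 2F 3F →
            ContainsInduced G H
  induced H (loopless , symmetric) w x y z wx wy wz xy xz yz ewx ewy ewz exy exz eyz =
    f , ordered-distinct⇒injective (fin4-ordered (λ i j → f i ≢ f j) wx wy wz xy xz yz)
      , ordered⇒total (fin4-ordered R (≡.sym ewx) (≡.sym ewy) (≡.sym ewz)
                                      (≡.sym exy) (≡.sym exz) (≡.sym eyz))
                      (λ {i} {j} e → trans (symmetric j i) (trans e (Graph.sym G (f i) (f j))))
                      (λ i → trans (loopless i) (≡.sym (irrefl G (f i))))
    where
    f : Fin 4 → V G
    f = lookup (w ∷ x ∷ y ∷ z ∷ [])
    R : Fin 4 → Fin 4 → Set
    R i j = adjM H i j ≡ adj G (f i) (f j)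

  P₃-end-has-unique-neighbour : Free4 G → Adj G a d → Adj G d b → ¬ Adj G a b → a ≢ b →
                                 Adj G a c → c ≡ d
  P₃-end-has-unique-neighbour {a = a} {d = d} {b = b} {c = c} (¬P4 , ¬C4 , ¬paw , ¬diamond) ad db ¬ab a≢b ac =
    decidable-stable (c FP.≟ d) c≢d-absurd
    where
    c≢a = ≢-sym (Adj⇒≢ ac)
    c≢b : c ≢ b
    c≢b refl = ¬ab ac
    a≢d = Adj⇒≢ ad
    d≢b = Adj⇒≢ db
    ab = ¬-not ¬ab
    c≢d-absurd : ¬ c ≢ d
    c≢d-absurd c≢d with adj G c d in cd | adj G c b in cb
    ... | false | true = ¬C4 (induced C4 C4-simple c a d b c≢a c≢d c≢b a≢d a≢b d≢b
                                (Adj-sym ac) cd cb ad ab db)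
    ... | false | false = ¬P4 (induced P4 P4-simple c a d b c≢a c≢d c≢b a≢d a≢b d≢b
                                 (Adj-sym ac) cd cb ad ab db)
    ... | true | false = ¬paw (induced Paw Paw-simple d a c b (≢-sym a≢d) (≢-sym c≢d) d≢b
                                 (≢-sym c≢a) a≢b c≢b (Adj-sym ad) (Adj-sym cd) db ac ab cb)
    ... | true | true = ¬diamond (induced Diamond Diamond-simple c d a b c≢d c≢a c≢b
                                    (≢-sym a≢d) d≢b a≢b cd (Adj-sym ac) cb (Adj-sym ad) db ab)

  WithinTwo : (V G → Set) → V G → V G → Set
  WithinTwo P x y = x ≡ y ⊎ Adj G x y ⊎ ∃ λ d → P d × Adj G x d × Adj G d y

  P₃-walk⇒withinTwo : ¬ ContainsInduced G P4 → Adj G x y → P y → Adj G y d → P d → Adj G d b →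
                       WithinTwo P x b
  P₃-walk⇒withinTwo {x = x} {y = y} {d = d} {b = b} ¬P4 xy Py yd Pd db
    with x FP.≟ b | adj? x b | adj? x d | adj? y b
  ... | yes x≡b | _ | _ | _ = inj₁ x≡b
  ... | no _ | yes xb | _ | _ = inj₂ (inj₁ xb)
  ... | no _ | no _ | yes xd | _ = inj₂ (inj₂ (d , Pd , xd , db))
  ... | no _ | no _ | no _ | yes yb = inj₂ (inj₂ (y , Py , xy , yb))
  ... | no x≢b | no ¬xb | no ¬xd | no ¬yb =
    ⊥-elim (¬P4 (induced P4 P4-simple x y d b (Adj⇒≢ xy) x≢d x≢b (Adj⇒≢ yd) y≢b (Adj⇒≢ db)
                         xy (¬-not ¬xd) (¬-not ¬xb) yd (¬-not ¬yb) db))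
    where
    x≢d : x ≢ d
    x≢d refl = ¬xb db
    y≢b : y ≢ b
    y≢b refl = ¬xb xy

  walk⇒withinTwo : ¬ ContainsInduced G P4 → Star (InducedEdge G P) x y → WithinTwo P x y
  walk⇒withinTwo ¬P4 ε = inj₁ refl
  walk⇒withinTwo ¬P4 ((xy , _ , Py) ◅ walk) with walk⇒withinTwo ¬P4 walk
  ... | inj₁ refl = inj₂ (inj₁ xy)
  ... | inj₂ (inj₁ yb) = inj₂ (inj₂ (_ , Py , xy , yb))
  ... | inj₂ (inj₂ (d , Pd , yd , db)) = P₃-walk⇒withinTwo ¬P4 xy Py yd Pd db

  nonadjacent⇒same-neighbour : Free4 G → Connected G → a ≢ b → ¬ Adj G a b →
                                Adj G a c → Adj G e b → e ≡ c
  nonadjacent⇒same-neighbour {a = a} {b = b} free conn a≢b ¬ab ac eb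
    with walk⇒withinTwo (proj₁ free) (Star.map (λ xy → xy , tt , tt) (conn a b))
  ... | inj₁ a≡b = ⊥-elim (a≢b a≡b)
  ... | inj₂ (inj₁ ab) = ⊥-elim (¬ab ab)
  ... | inj₂ (inj₂ (d , _ , ad , db)) =
    trans (P₃-end-has-unique-neighbour free (Adj-sym db) (Adj-sym ad) (¬ab ∘ Adj-sym) (≢-sym a≢b) (Adj-sym eb))
          (≡.sym (P₃-end-has-unique-neighbour free ad db ¬ab a≢b ac))

  position : Ordering G → V G → ℕ
  position σ x = toℕ (σ ⟨$⟩ʳ x)

  module _ (σ : Ordering G) where

    Before⇒≢ : Before G σ x y → x ≢ y
    Before⇒≢ x<y refl = NP.<-irrefl refl x<y

    SkipFree : Set
    SkipFree = ∀ a b c → Before G σ a b → Before G σ b c → Adj G a c → ¬ Adj G a b → ⊥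

    skipFree⇒BFS : SkipFree → IsBFS G σ
    skipFree⇒BFS skipFree a b c a<b b<c ac ¬ab = ⊥-elim (skipFree a b c a<b b<c ac ¬ab)

    skipFree⇒DFS : SkipFree → IsDFS G σ
    skipFree⇒DFS skipFree a b c a<b b<c ac ¬ab = ⊥-elim (skipFree a b c a<b b<c ac ¬ab)

    module _ (free : Free4 G) (conn : Connected G) where

      search⇒skipFree : IsSearch G σ → SkipFree
      search⇒skipFree search a b c a<b b<c ac ¬ab
        with walk⇒withinTwo (proj₁ free) (search (suc (position σ b)) a b (NP.m<n⇒m<1+n a<b) (NP.n<1+n _))
      ... | inj₁ a≡b = Before⇒≢ a<b a≡b
      ... | inj₂ (inj₁ ab) = ¬ab ab
      ... | inj₂ (inj₂ (d , d≤b , ad , db)) with nonadjacent⇒same-neighbour free conn (Before⇒≢ a<b) ¬ab ac db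
      ...   | refl = NP.<⇒≱ b<c (ℕ.s≤s⁻¹ d≤b)

      BFS⇒skipFree : IsBFS G σ → SkipFree
      BFS⇒skipFree bfs a b c a<b b<c ac ¬ab with bfs a b c a<b b<c ac ¬ab
      ... | d , d<a , db with nonadjacent⇒same-neighbour free conn (Before⇒≢ a<b) ¬ab ac db
      ...   | refl = NP.<-asym d<a (NP.<-trans a<b b<c)

      DFS⇒skipFree : IsDFS G σ → SkipFree
      DFS⇒skipFree dfs a b c a<b b<c ac ¬ab with dfs a b c a<b b<c ac ¬ab
      ... | d , _ , d<b , db with nonadjacent⇒same-neighbour free conn (Before⇒≢ a<b) ¬ab ac db
      ...   | refl = NP.<-asym d<b b<c

  Visited : (ℕ → V G) → ℕ → V G → Set
  Visited s k v = ∃ λ i → i < k × s i ≡ v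

  visited? : ∀ s k v → Dec (Visited s k v)
  visited? s k v = NP.anyUpTo? (λ i → s i FP.≟ v) k

  AgreeBelow : ℕ → (ℕ → V G) → (ℕ → V G) → Set
  AgreeBelow k s t = ∀ {i} → i < k → s i ≡ t i

  visited-cong : AgreeBelow k s t → Visited s k v → Visited t k v
  visited-cong s≗t (i , i<k , sᵢ≡v) = i , i<k , trans (≡.sym (s≗t i<k)) sᵢ≡v

  -- The BFS condition for the triples s α, x, v whose middle vertex x comes right after the
  -- prefix s 0, …, s (k - 1); the last vertex v then ranges over the unvisited vertices.
  BreadthFirstStep : (ℕ → V G) → ℕ → V G → Set
  BreadthFirstStep s k x = ∀ {α v} → α < k → ¬ Visited s k v → Adj G (s α) v → ¬ Adj G (s α) x →
                           ∃ λ δ → δ < α × Adj G (s δ) x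

  BreadthFirstAt : (ℕ → V G) → ℕ → Set
  BreadthFirstAt s i = BreadthFirstStep s i (s i)

  breadthFirstStep-cong : AgreeBelow k s t → BreadthFirstStep s k x → BreadthFirstStep t k x
  breadthFirstStep-cong {x = x} s≗t step {α} α<k ¬visited αv ¬αx
    with step α<k (¬visited ∘ visited-cong s≗t) (subst (λ y → Adj G y _) (≡.sym (s≗t α<k)) αv)
                  (¬αx ∘ subst (λ y → Adj G y x) (s≗t α<k))
  ... | δ , δ<α , δx = δ , δ<α , subst (λ y → Adj G y x) (s≗t (NP.<-trans δ<α α<k)) δx

  breadthFirstAt-cong : ∀ {i} → AgreeBelow (suc i) s t → BreadthFirstAt s i → BreadthFirstAt t i
  breadthFirstAt-cong {t = t} {i} s≗t =
    subst (BreadthFirstStep t i) (s≗t (NP.n<1+n i)) ∘ breadthFirstStep-cong (s≗t ∘ NP.m<n⇒m<1+n)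

  Frontier : (ℕ → V G) → ℕ → ℕ → Set
  Frontier s k α = α < k × ∃ λ x → ¬ Visited s k x × Adj G (s α) x

  frontier? : ∀ s k → Decidable (Frontier s k)
  frontier? s k α = (α ℕ.<? k) ×-dec FP.any? (λ x → ¬? (visited? s k x) ×-dec adj? (s α) x)

  record BreadthFirstSuccessor (s : ℕ → V G) (k : ℕ) : Set where
    field
      vertex : V G
      unvisited : ¬ Visited s k vertex
      parent : ∃ λ j → j < k × Adj G (s j) vertex
      breadthFirst : BreadthFirstStep s k vertex

  -- The successor is a neighbour of the earliest vertex that still has an unvisited neighbour.
  breadthFirstSuccessor : Connected G → ∀ s → 0 < k → ¬ Visited s k u → BreadthFirstSuccessor s k
  breadthFirstSuccessor {k} {u} conn s 0<k ¬visited-u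
    with walk-exits (visited? s k) (conn (s 0) u) (0 , 0<k , refl) ¬visited-u
  ... | _ , x , sᵢx , (i , i<k , refl) , ¬visited-x
    with least-witness (frontier? s k) (i<k , x , ¬visited-x , sᵢx)
  ... | α , (α<k , y , ¬visited-y , αy) , minimal = record
    { vertex = y ; unvisited = ¬visited-y ; parent = α , α<k , αy ; breadthFirst = breadthFirst }
    where
    breadthFirst : BreadthFirstStep s k y
    breadthFirst β<k ¬visited-v βv ¬βy = α , α<β , αy
      where
      α<β = NP.≤∧≢⇒< (NP.≮⇒≥ λ β<α → minimal β<α (β<k , _ , ¬visited-v , βv)) λ { refl → ¬βy αy }

  record SearchPrefix (k : ℕ) : Set where
    field
      seq : ℕ → V G
      distinct : ∀ {i j} → i < j → j < k → seq i ≢ seq j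
      parent : ∀ {i} → 0 < i → i < k → ∃ λ j → j < i × Adj G (seq j) (seq i)

    seq-injective : ∀ {i j} → i < k → j < k → seq i ≡ seq j → i ≡ j
    seq-injective {i} {j} i<k j<k sᵢ≡sⱼ with NP.<-cmp i j
    ... | tri< i<j _ _ = ⊥-elim (distinct i<j j<k sᵢ≡sⱼ)
    ... | tri≈ _ i≡j _ = i≡j
    ... | tri> _ _ j<i = ⊥-elim (distinct j<i i<k (≡.sym sᵢ≡sⱼ))

    length≤n : k ≤ n G
    length≤n = FP.injective⇒≤ {f = seq ∘ toℕ}
      (FP.toℕ-injective ∘ seq-injective (FP.toℕ<n _) (FP.toℕ<n _))

  open SearchPrefix

  snoc : (ℕ → V G) → ℕ → V G → ℕ → V G
  snoc s k x i with i ℕ.≟ k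
  ... | yes _ = x
  ... | no _ = s i

  snoc-agrees : ∀ s k x → AgreeBelow k s (snoc s k x)
  snoc-agrees s k x {i} i<k with i ℕ.≟ k
  ... | yes refl = ⊥-elim (NP.<-irrefl refl i<k)
  ... | no _ = refl

  snoc-last : ∀ s k x → snoc s k x k ≡ x
  snoc-last s k x with k ℕ.≟ k
  ... | yes _ = refl
  ... | no k≢k = ⊥-elim (k≢k refl)

  extend : (p : SearchPrefix k) → ¬ Visited (seq p) k x → ∃ (λ j → j < k × Adj G (seq p j) x) →
           SearchPrefix (suc k)
  extend {k} {x} p ¬visited (j , j<k , jx) = record { seq = s′ ; distinct = distinct′ ; parent = parent′ }
    where
    s′ = snoc (seq p) k x
    agrees = snoc-agrees (seq p) k x
    last = snoc-last (seq p) k x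
    distinct′ : ∀ {i j} → i < j → j < suc k → s′ i ≢ s′ j
    distinct′ {i} {j} i<j j≤k with NP.m<1+n⇒m<n∨m≡n j≤k
    ... | inj₁ j<k = λ s′ᵢ≡s′ⱼ →
      distinct p i<j j<k (trans (agrees (NP.<-trans i<j j<k)) (trans s′ᵢ≡s′ⱼ (≡.sym (agrees j<k))))
    ... | inj₂ refl = λ sᵢ≡x → ¬visited (i , i<j , trans (agrees i<j) (trans sᵢ≡x last))
    parent′ : ∀ {i} → 0 < i → i < suc k → ∃ λ j → j < i × Adj G (s′ j) (s′ i)
    parent′ {i} 0<i i≤k with NP.m<1+n⇒m<n∨m≡n i≤k
    ... | inj₁ i<k with parent p 0<i i<k
    ...   | j′ , j′<i , edge = j′ , j′<i , subst₂ (Adj G) (agrees (NP.<-trans j′<i i<k)) (agrees i<k) edge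
    parent′ 0<i i≤k | inj₂ refl = j , j<k , subst₂ (Adj G) (agrees j<k) (≡.sym last) jx

  Spanning : (ℕ → V G) → ℕ → Set
  Spanning s k = ∀ v → Visited s k v

  spanning⇒n≤ : Spanning s k → n G ≤ k
  spanning⇒n≤ {s} {k} span = FP.injective⇒≤ {f = index} index-injective
    where
    index : V G → Fin k
    index v = fromℕ< (proj₁ (proj₂ (span v)))
    index-injective : ∀ {u v} → index u ≡ index v → u ≡ v
    index-injective {u} {v} eq =
      trans (≡.sym (proj₂ (proj₂ (span u))))
            (trans (cong s (FP.fromℕ<-injective _ _ _ _ eq)) (proj₂ (proj₂ (span v))))

  module _ (q : SearchPrefix (n G)) (span : Spanning (seq q) (n G)) where

    private
      index<n : ∀ v → proj₁ (span v) < n G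
      index<n v = proj₁ (proj₂ (span v))

      seq-index : ∀ v → seq q (proj₁ (span v)) ≡ v
      seq-index v = proj₂ (proj₂ (span v))

      index-seq : ∀ {i} → i < n G → toℕ (fromℕ< (index<n (seq q i))) ≡ i
      index-seq {i} i<n = trans (FP.toℕ-fromℕ< _) (seq-injective q (index<n _) i<n (seq-index (seq q i)))

    orderingOf : Ordering G
    orderingOf = permutation (λ v → fromℕ< (index<n v)) (seq q ∘ toℕ)
      (λ i → FP.toℕ-injective (index-seq (FP.toℕ<n i)))
      (λ v → trans (cong (seq q) (FP.toℕ-fromℕ< _)) (seq-index v))

    position-seq : ∀ {i} → i < n G → position orderingOf (seq q i) ≡ i
    position-seq = index-seq

    seq-position : ∀ v → seq q (position orderingOf v) ≡ v
    seq-position v = trans (cong (seq q) (FP.toℕ-fromℕ< _)) (seq-index v)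

    private
      Earlier : ℕ → V G → Set
      Earlier k x = position orderingOf x < k

      root-walk : ∀ {k} i → i < n G → i < k → Star (InducedEdge G (Earlier k)) (seq q 0) (seq q i)
      root-walk {k} = <-rec _ walk
        where
        RootWalk : ℕ → Set
        RootWalk i = i < n G → i < k → Star (InducedEdge G (Earlier k)) (seq q 0) (seq q i)
        walk : ∀ i → (∀ {j} → j < i → RootWalk j) → RootWalk i
        walk zero _ _ _ = ε
        walk (suc i) rec i<n i<k with parent q (s≤s z≤n) i<n
        ... | j , j<i , edge = rec j<i j<n j<k ◅◅ ((edge , earlier j<n j<k , earlier i<n i<k) ◅ ε)
          where
          j<n = NP.<-trans j<i i<n
          j<k = NP.<-trans j<i i<k
          earlier : ∀ {l} → l < n G → l < k → Earlier k (seq q l)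
          earlier l<n l<k = subst (_< k) (≡.sym (position-seq l<n)) l<k

      walk-to : ∀ {k} v → Earlier k v → Star (InducedEdge G (Earlier k)) (seq q 0) v
      walk-to v v<k = subst (Star _ (seq q 0)) (seq-position v) (root-walk _ (FP.toℕ<n _) v<k)

    orderingOf-search : IsSearch G orderingOf
    orderingOf-search k u v u<k v<k =
      Star.reverse (λ { (xy , x<k , y<k) → Adj-sym xy , y<k , x<k }) (walk-to u u<k) ◅◅ walk-to v v<k

    orderingOf-BFS : (∀ {i} → i < n G → BreadthFirstAt (seq q) i) → IsBFS G orderingOf
    orderingOf-BFS breadthFirst a b c a<b b<c ac ¬ab
      with breadthFirst (FP.toℕ<n (orderingOf ⟨$⟩ʳ b)) a<b ¬visited-c
             (subst (λ x → Adj G x c) (≡.sym (seq-position a)) ac)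
             (¬ab ∘ subst₂ (Adj G) (seq-position a) (seq-position b))
      where
      ¬visited-c : ¬ Visited (seq q) (position orderingOf b) c
      ¬visited-c (i , i<b , refl) =
        NP.<-asym b<c (subst (_< position orderingOf b) (≡.sym (position-seq (NP.<-trans i<b (FP.toℕ<n _)))) i<b)
    ... | δ , δ<a , δb = seq q δ
                       , subst (_< position orderingOf a) (≡.sym (position-seq (NP.<-trans δ<a (FP.toℕ<n _)))) δ<a
                       , subst (Adj G (seq q δ)) (seq-position b) δb

  record SearchOrderingExtending {k₀ : ℕ} (p : SearchPrefix k₀) : Set where
    field
      σ : Ordering G
      search : IsSearch G σ
      position-prefix : ∀ {i} → i < k₀ → position σ (seq p i) ≡ i
      position-rest : ∀ {x} → ¬ Visited (seq p) k₀ x → k₀ ≤ position σ x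
      bfs : (∀ {i} → i < k₀ → BreadthFirstAt (seq p) i) → IsBFS G σ

  module _ (conn : Connected G) {k₀ : ℕ} (p : SearchPrefix k₀) (0<k₀ : 0 < k₀) where

    record Extension (k : ℕ) : Set where
      field
        prefix : SearchPrefix k
        k₀≤k : k₀ ≤ k
        agrees : AgreeBelow k₀ (seq p) (seq prefix)
        breadthFirst : ∀ {i} → k₀ ≤ i → i < k → BreadthFirstAt (seq prefix) i

    open Extension

    start : Extension k₀
    start = record
      { prefix = p ; k₀≤k = NP.≤-refl ; agrees = λ _ → refl
      ; breadthFirst = λ k₀≤i i<k₀ → ⊥-elim (NP.<⇒≱ i<k₀ k₀≤i) }

    grow : (e : Extension k) → ¬ Visited (seq (prefix e)) k u → Extension (suc k)
    grow {k} e ¬visited-u = record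
      { prefix = extend (prefix e) S.unvisited S.parent
      ; k₀≤k = NP.m≤n⇒m≤1+n (k₀≤k e)
      ; agrees = λ i<k₀ → trans (agrees e i<k₀) (agrees′ (NP.<-≤-trans i<k₀ (k₀≤k e)))
      ; breadthFirst = breadthFirst′ }
      where
      old = seq (prefix e)
      module S = BreadthFirstSuccessor (breadthFirstSuccessor conn old (NP.<-≤-trans 0<k₀ (k₀≤k e)) ¬visited-u)
      new = snoc old k S.vertex
      agrees′ : AgreeBelow k old new
      agrees′ = snoc-agrees old k S.vertex
      breadthFirst′ : ∀ {i} → k₀ ≤ i → i < suc k → BreadthFirstAt new i
      breadthFirst′ {i} k₀≤i i≤k with NP.m<1+n⇒m<n∨m≡n i≤k
      ... | inj₁ i<k = breadthFirstAt-cong (agrees′ ∘ λ j≤i → NP.<-≤-trans j≤i i<k) (breadthFirst e k₀≤i i<k)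
      ... | inj₂ refl = subst (BreadthFirstStep new k) (≡.sym (snoc-last old k S.vertex))
                          (breadthFirstStep-cong agrees′ S.breadthFirst)

    saturate : ∀ m → n G ≤ m + k → Extension k →
               ∃ λ k → Σ (Extension k) λ e → Spanning (seq (prefix e)) k
    saturate {k} m n≤m+k e with FP.any? (λ u → ¬? (visited? (seq (prefix e)) k u))
    ... | no none = k , e , λ v → decidable-stable (visited? _ k v) (λ ¬visited → none (v , ¬visited))
    ... | yes (u , ¬visited-u) with m
    ...   | zero = ⊥-elim (NP.<⇒≱ (length≤n (prefix (grow e ¬visited-u))) n≤m+k)
    ...   | suc m′ = saturate m′ (subst (n G ≤_) (≡.sym (NP.+-suc m′ k)) n≤m+k) (grow e ¬visited-u)

    spanningExtension : Σ (Extension (n G)) λ e → Spanning (seq (prefix e)) (n G)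
    spanningExtension with saturate (n G) (NP.m≤m+n (n G) k₀) start
    ... | k , e , span with NP.≤-antisym (length≤n (prefix e)) (spanning⇒n≤ span)
    ...   | refl = e , span

    searchOrderingExtending : SearchOrderingExtending p
    searchOrderingExtending = record
      { σ = σ
      ; search = orderingOf-search q span
      ; position-prefix = λ i<k₀ → trans (cong (position σ) (agrees ext i<k₀)) (position-seq q span (<n i<k₀))
      ; position-rest = λ ¬visited → NP.≮⇒≥ λ x<k₀ →
          ¬visited (_ , x<k₀ , trans (agrees ext x<k₀) (seq-position q span _))
      ; bfs = λ prefix-breadthFirst → orderingOf-BFS q span (breadthFirst-everywhere prefix-breadthFirst) }
      where
      ext = proj₁ spanningExtension
      span = proj₂ spanningExtension
      q = prefix ext
      σ = orderingOf q span
      <n : ∀ {i} → i < k₀ → i < n G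
      <n i<k₀ = NP.<-≤-trans i<k₀ (k₀≤k ext)
      breadthFirst-everywhere : (∀ {i} → i < k₀ → BreadthFirstAt (seq p) i) →
                                ∀ {i} → i < n G → BreadthFirstAt (seq q) i
      breadthFirst-everywhere prefix-breadthFirst {i} i<n with i ℕ.<? k₀
      ... | yes i<k₀ = breadthFirstAt-cong (agrees ext ∘ λ j≤i → NP.<-≤-trans j≤i i<k₀) (prefix-breadthFirst i<k₀)
      ... | no i≮k₀ = breadthFirst ext (NP.≮⇒≥ i≮k₀) i<n

module _ (G : Graph) where

  record Obstruction : Set where
    field
      r a b c : V G
      ra : Adj G r a
      rb : Adj G r b
      ac : Adj G a c
      ¬ab : ¬ Adj G a b
      a≢b : a ≢ b
      r≢c : r ≢ c
      b≢c : b ≢ c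

  obstruction : (H : Mat4) (r a b c : Fin 4) → ContainsInduced G H →
                adjM H r a ≡ true → adjM H r b ≡ true → adjM H a c ≡ true → adjM H a b ≡ false →
                a ≢ b → r ≢ c → b ≢ c → Obstruction
  obstruction H r a b c (f , f-injective , f-induced) ra rb ac ab a≢b r≢c b≢c = record
    { r = f r ; a = f a ; b = f b ; c = f c
    ; ra = trans (≡.sym (f-induced r a)) ra
    ; rb = trans (≡.sym (f-induced r b)) rb
    ; ac = trans (≡.sym (f-induced a c)) ac
    ; ¬ab = λ fab → case trans (≡.sym ab) (trans (f-induced a b) fab) of λ ()
    ; a≢b = a≢b ∘ f-injective
    ; r≢c = r≢c ∘ f-injective
    ; b≢c = b≢c ∘ f-injective }

  noObstruction⇒free : ¬ Obstruction → Free4 G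
  noObstruction⇒free ¬obstruction =
      (¬obstruction ∘ λ i → obstruction P4 1F 2F 0F 3F i refl refl refl refl (λ ()) (λ ()) (λ ()))
    , (¬obstruction ∘ λ i → obstruction C4 0F 1F 3F 2F i refl refl refl refl (λ ()) (λ ()) (λ ()))
    , (¬obstruction ∘ λ i → obstruction Paw 0F 1F 3F 2F i refl refl refl refl (λ ()) (λ ()) (λ ()))
    , (¬obstruction ∘ λ i → obstruction Diamond 0F 2F 3F 1F i refl refl refl refl (λ ()) (λ ()) (λ ()))

  module _ (conn : Connected G) (o : Obstruction) where
    open Obstruction o

    rab-seq : ℕ → V G
    rab-seq 0 = r
    rab-seq 1 = a
    rab-seq _ = b

    rab : SearchPrefix G 3
    rab = record { seq = rab-seq ; distinct = distinct ; parent = parent }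
      where
      distinct : ∀ {i j} → i < j → j < 3 → rab-seq i ≢ rab-seq j
      distinct {0} {1} _ _ = Adj⇒≢ G ra
      distinct {0} {2} _ _ = Adj⇒≢ G rb
      distinct {1} {2} _ _ = a≢b
      distinct {_} {0} () _
      distinct {suc _} {1} (s≤s ()) _
      distinct {suc (suc _)} {2} (s≤s (s≤s ())) _
      distinct {_} {suc (suc (suc _))} _ (s≤s (s≤s (s≤s ())))
      parent : ∀ {i} → 0 < i → i < 3 → ∃ λ j → j < i × Adj G (rab-seq j) (rab-seq i)
      parent {1} _ _ = 0 , s≤s z≤n , ra
      parent {2} _ _ = 0 , s≤s z≤n , rb
      parent {suc (suc (suc _))} _ (s≤s (s≤s (s≤s ())))

    rab-breadthFirst : ∀ {i} → i < 3 → BreadthFirstAt G rab-seq i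
    rab-breadthFirst {1} _ {α = 0} _ _ _ ¬ra = ⊥-elim (¬ra ra)
    rab-breadthFirst {2} _ {α = 0} _ _ _ ¬rb = ⊥-elim (¬rb rb)
    rab-breadthFirst {2} _ {α = 1} _ _ _ _ = 0 , s≤s z≤n , rb
    rab-breadthFirst {1} _ {α = suc _} (s≤s ())
    rab-breadthFirst {2} _ {α = suc (suc _)} (s≤s (s≤s ()))
    rab-breadthFirst {suc (suc (suc _))} (s≤s (s≤s (s≤s ())))

    breadthFirst-not-depthFirst : ∃ λ σ → IsSearch G σ × IsBFS G σ × ¬ IsDFS G σ
    breadthFirst-not-depthFirst = σ , search , bfs rab-breadthFirst , ¬dfs
      where
      open SearchOrderingExtending (searchOrderingExtending G conn rab (s≤s z≤n))
      a↦1 : position G σ a ≡ 1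
      a↦1 = position-prefix (s≤s (s≤s z≤n))
      b↦2 : position G σ b ≡ 2
      b↦2 = position-prefix (s≤s (s≤s (s≤s z≤n)))
      c-late : 3 ≤ position G σ c
      c-late = position-rest λ { (0 , _ , r≡c) → r≢c r≡c
                               ; (1 , _ , a≡c) → Adj⇒≢ G ac a≡c
                               ; (2 , _ , b≡c) → b≢c b≡c
                               ; (suc (suc (suc _)) , s≤s (s≤s (s≤s ())) , _) }
      ¬dfs : ¬ IsDFS G σ
      ¬dfs dfs with dfs a b c (subst₂ _<_ (≡.sym a↦1) (≡.sym b↦2) (s≤s (s≤s z≤n)))
                              (subst (_< position G σ c) (≡.sym b↦2) c-late) ac ¬ab
      ... | d , a<d , d<b , _ = NP.<⇒≱ (subst (_< position G σ d) a↦1 a<d)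
                                       (ℕ.s≤s⁻¹ (subst (position G σ d <_) b↦2 d<b))

    arbc-seq : ℕ → V G
    arbc-seq 0 = a
    arbc-seq 1 = r
    arbc-seq 2 = b
    arbc-seq _ = c

    arbc : SearchPrefix G 4
    arbc = record { seq = arbc-seq ; distinct = distinct ; parent = parent }
      where
      distinct : ∀ {i j} → i < j → j < 4 → arbc-seq i ≢ arbc-seq j
      distinct {0} {1} _ _ = ≢-sym (Adj⇒≢ G ra)
      distinct {0} {2} _ _ = a≢b
      distinct {0} {3} _ _ = Adj⇒≢ G ac
      distinct {1} {2} _ _ = Adj⇒≢ G rb
      distinct {1} {3} _ _ = r≢c
      distinct {2} {3} _ _ = b≢c
      distinct {_} {0} () _
      distinct {suc _} {1} (s≤s ()) _
      distinct {suc (suc _)} {2} (s≤s (s≤s ())) _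
      distinct {suc (suc (suc _))} {3} (s≤s (s≤s (s≤s ()))) _
      distinct {_} {suc (suc (suc (suc _)))} _ (s≤s (s≤s (s≤s (s≤s ()))))
      parent : ∀ {i} → 0 < i → i < 4 → ∃ λ j → j < i × Adj G (arbc-seq j) (arbc-seq i)
      parent {1} _ _ = 0 , s≤s z≤n , Adj-sym G ra
      parent {2} _ _ = 1 , s≤s (s≤s z≤n) , rb
      parent {3} _ _ = 0 , s≤s z≤n , ac
      parent {suc (suc (suc (suc _)))} _ (s≤s (s≤s (s≤s (s≤s ()))))

    search-not-breadthFirst : ∃ λ σ → IsSearch G σ × ¬ IsBFS G σ
    search-not-breadthFirst = σ , search , ¬bfs
      where
      open SearchOrderingExtending (searchOrderingExtending G conn arbc (s≤s z≤n))
      a↦0 : position G σ a ≡ 0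
      a↦0 = position-prefix (s≤s z≤n)
      b↦2 : position G σ b ≡ 2
      b↦2 = position-prefix (s≤s (s≤s (s≤s z≤n)))
      c↦3 : position G σ c ≡ 3
      c↦3 = position-prefix (s≤s (s≤s (s≤s (s≤s z≤n))))
      ¬bfs : ¬ IsBFS G σ
      ¬bfs bfs with bfs a b c (subst₂ _<_ (≡.sym a↦0) (≡.sym b↦2) (s≤s z≤n))
                              (subst₂ _<_ (≡.sym b↦2) (≡.sym c↦3) (s≤s (s≤s (s≤s z≤n)))) ac ¬ab
      ... | d , d<a , _ = NP.n≮0 (subst (position G σ d <_) a↦0 d<a)

theorem1 : (G : Graph) → Connected G →
    (Free4 G ⇔ (∀ σ → IsSearch G σ → IsDFS G σ))
    × (Free4 G ⇔ (∀ σ → IsSearch G σ → IsBFS G σ))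
    × (Free4 G ⇔ (∀ σ → (IsBFS G σ ⇔ IsDFS G σ)))
theorem1 G conn =
    mk⇔ (λ free σ → skipFree⇒DFS G σ ∘ search⇒skipFree G σ free conn)
        (λ searches-DFS → noObstruction⇒free G λ o →
          let σ , search , _ , ¬dfs = breadthFirst-not-depthFirst G conn o in ¬dfs (searches-DFS σ search))
  , mk⇔ (λ free σ → skipFree⇒BFS G σ ∘ search⇒skipFree G σ free conn)
        (λ searches-BFS → noObstruction⇒free G λ o →
          let σ , search , ¬bfs = search-not-breadthFirst G conn o in ¬bfs (searches-BFS σ search))
  , mk⇔ (λ free σ → mk⇔ (skipFree⇒DFS G σ ∘ BFS⇒skipFree G σ free conn)
                         (skipFree⇒BFS G σ ∘ DFS⇒skipFree G σ free conn))
        (λ BFS⇔DFS → noObstruction⇒free G λ o →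
          let σ , _ , bfs , ¬dfs = breadthFirst-not-depthFirst G conn o in ¬dfs (Equivalence.to (BFS⇔DFS σ) bfs))
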